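{- For every $\pi\in\mathrm{Av}(231)$, the permutations $\pi$ and $P(\pi)$ have - the same number and positions of right-to-left maxima, - the same number and positions of left-to-right maxima, and - the same up-down word.
   Context: The bijection $P$. - $\mathrm{Av}(231)$ (resp. $\mathrm{Av}(132)$) is the set of permutations avoiding $231$ (resp. $132$). - $\alpha\oplus\beta=\alpha(\beta+|\alpha|)$ and $\alpha\ominus\beta=(\alpha+|\beta|)\beta$. - Every nonempty $\pi\in\mathrm{Av}(231)$ is uniquely $\alpha\oplus(1\ominus\beta)$ with $\alpha,\beta\in\mathrm{Av}(231)$. - $P:\mathrm{Av}(231)\to\mathrm{Av}(132)$ is defined by $P(\varepsilon)=\varepsilon$ and $P(\alpha\oplus(1\ominus\beta))=(P(\alpha)\oplus1)\ominus P(\beta)$. Statistics. - A left-to-right (resp. right-to-left) maximum of $\pi$ is an entry $\pi(i)$ larger than all $\pi(j)$ with $j<i$ (resp. $j>i$). - The up-down word of $\pi$ of size $n$ is $w\in\{u,d\}^{n-1}$ with $w(i)=u$ iff $\pi(i)<\pi(i+1)$. -}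

module Defs where

open import Data.Nat using (ℕ; zero; suc; _+_; _∸_; _<_; _<ᵇ_; _⊔_)
open import Data.Nat.Properties using (_≟_)
open import Data.Bool using (Bool; true; false)
open import Data.List using (List; []; _∷_; _++_; map; length; lookup; upTo; foldr; break)
open import Data.Fin using (Fin; toℕ) renaming (_<_ to _<ᶠ_)
open import Data.Product using (Σ; _×_; _,_)
open import Data.List.Relation.Binary.Permutation.Propositional using (_↭_)
open import Relation.Nullary using (¬_)

IsPerm : List ℕ → Set
IsPerm π = π ↭ map suc (upTo (length π))

Contains231 : List ℕ → Set
Contains231 π =
  Σ (Fin (length π)) λ i → Σ (Fin (length π)) λ j → Σ (Fin (length π)) λ k →
    (i <ᶠ j) × (j <ᶠ k) × (lookup π k < lookup π i) × (lookup π i < lookup π j)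

Av231 : List ℕ → Set
Av231 π = IsPerm π × ¬ Contains231 π

maxL : List ℕ → ℕ
maxL = foldr _⊔_ 0

-- The bijection P.  A nonempty π ∈ Av(231) of size n is written
-- π = α n β' where n is its maximum; then α ∈ Av(231) on {1..|α|} and
-- β' = β + |α|, i.e. π = α ⊕ (1 ⊖ β).  P(π) = (P(α) ⊕ 1) ⊖ P(β)
--                                        = (P(α)+|β|) n P(β).
-- Fuel (the length) makes the recursion structural.
Pfuel : ℕ → List ℕ → List ℕ
Pfuel zero _ = []
Pfuel (suc f) [] = []
Pfuel (suc f) π@(_ ∷ _) with break (_≟ maxL π) π
... | α , [] = []
... | α , (_ ∷ β') =
  let a = length α
      β = map (λ x → x ∸ a) β'
      b = length β
      Pα = Pfuel f α
      Pβ = Pfuel f β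
  in map (λ x → x + b) Pα ++ (suc (a + b) ∷ Pβ)

P : List ℕ → List ℕ
P π = Pfuel (length π) π

truePositionsFrom : ℕ → List Bool → List ℕ
truePositionsFrom i [] = []
truePositionsFrom i (true ∷ bs) = i ∷ truePositionsFrom (suc i) bs
truePositionsFrom i (false ∷ bs) = truePositionsFrom (suc i) bs

rlFlags : List ℕ → List Bool
rlFlags [] = []
rlFlags (x ∷ xs) = (maxL xs <ᵇ x) ∷ rlFlags xs

lrFlagsFrom : ℕ → List ℕ → List Bool
lrFlagsFrom m [] = []
lrFlagsFrom m (x ∷ xs) = (m <ᵇ x) ∷ lrFlagsFrom (m ⊔ x) xs

-- entries of a permutation are ≥ 1, so starting with 0 is correct
lrFlags : List ℕ → List Bool
lrFlags = lrFlagsFrom 0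

rlMaxPositions : List ℕ → List ℕ
rlMaxPositions π = truePositionsFrom 0 (rlFlags π)

lrMaxPositions : List ℕ → List ℕ
lrMaxPositions π = truePositionsFrom 0 (lrFlags π)

data UD : Set where
  u d : UD

upDown : List ℕ → List UD
upDown [] = []
upDown (x ∷ []) = []
upDown (x ∷ y ∷ xs) = (if' (x <ᵇ y)) ∷ upDown (y ∷ xs)
  where
  if' : Bool → UD
  if' true = u
  if' false = d

-- Write π ∈ Av(231) as α n β with n = |π| its maximum. Avoiding 231 forces every entry
-- of α below every entry of β, so α is a permutation of 1..|α| and β one of
-- |α|+1..|α|+|β|, and P π = (P α + |β|) n P β. In both π and P π the maximum n is the last
-- left-to-right maximum, the first right-to-left maximum and a peak of the up-down word, so
-- the statistics of π are determined by those of α and β, and those of P π by those of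
-- P α + |β| and P β. Shifting values changes none of them, so the claim follows by induction.

module Submission where

open import Defs
open import Data.Bool using (true; false)
open import Data.Empty using (⊥-elim)
open import Data.Fin using (Fin; zero; suc; toℕ)
open import Data.Fin.Properties using (toℕ<n)
open import Data.List
  using (List; []; _∷_; _++_; _∷ʳ_; map; length; lookup; replicate; upTo; applyUpTo; break; dropWhile)
open import Data.List.Properties
  using ( length-++; length-map; ∷-injectiveˡ; ∷-injectiveʳ; ∷ʳ-injective
        ; map-applyUpTo; applyUpTo-∷ʳ; length-applyUpTo; span-defn; takeWhile++dropWhile )
open import Data.List.Membership.Propositional using (_∈_)
open import Data.List.Membership.Propositional.Properties using (∈-++⁺ʳ)
open import Data.List.Relation.Unary.All as All using (All; []; _∷_)
import Data.List.Relation.Unary.All.Properties as Allₚ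
open import Data.List.Relation.Unary.Any using (here; there; index)
open import Data.List.Relation.Unary.Any.Properties using (lookup-index)
open import Data.List.Relation.Unary.AllPairs using (AllPairs; []; _∷_)
import Data.List.Relation.Unary.AllPairs.Properties as AllPairsₚ
open import Data.List.Relation.Binary.Permutation.Propositional using (_↭_; ↭-sym; ↭-trans; ↭⇒↭ₛ′)
import Data.List.Relation.Binary.Permutation.Propositional.Properties as ↭ₚ
open import Data.List.Relation.Binary.Pointwise using (Pointwise-≡⇒≡)
import Data.List.Relation.Unary.Sorted.TotalOrder.Properties as Sortedₚ
open import Data.Maybe.Relation.Unary.All using (just)
open import Data.Nat using (ℕ; zero; suc; _+_; _∸_; _≤_; _<_; _<ᵇ_; _⊔_; z≤n; s≤s; s≤s⁻¹; z<s)
open import Data.Nat.Properties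
  using ( _≟_; _≤?_; _<?_; ≤-refl; ≤-reflexive; ≤-trans; ≤-totalOrder; ≤-decTotalOrder
        ; <⇒≤; ≮⇒≥; ≤∧≢⇒<; <⇒≱; m≤n⇒m≤1+n; suc-injective; <ᵇ-reflects-<; <ᵇ⇒<; <⇒<ᵇ
        ; m≤m+n; m≤n+m; +-suc; +-monoˡ-≤; +-monoʳ-≤; +-monoˡ-<; +-monoʳ-<; +-cancelʳ-<
        ; ⊔-sel; m≤m⊔n; m≤n⊔m; ⊔-identityʳ; ⊔-assoc; ⊔-lub; m≥n⇒m⊔n≡m; m≤n⇒m≤o⊔n; +-distribʳ-⊔
        ; 0∸n≡0; m+n∸m≡n; m≤n⇒m∸n≡0; m<n⇒0<n∸m; ∸-monoˡ-≤; ∸-monoˡ-<; ∸-distribʳ-⊔ )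
open import Data.List.Sort ≤-decTotalOrder using (sort; sort-↭; sort-↗)
open import Data.Product using (Σ; _×_; _,_; proj₁; proj₂; map₁; uncurry)
open import Data.Sum using (inj₁; inj₂)
open import Function using (_∘_; _⇔_; mk⇔; Equivalence)
open import Relation.Binary.PropositionalEquality
  using (_≡_; _≢_; refl; sym; isEquivalence; trans; cong; cong₂; subst; subst₂; module ≡-Reasoning)
open import Relation.Nullary using (¬?; yes; no)
open import Relation.Nullary.Decidable using (decidable-stable)
open import Relation.Nullary.Reflects using (ofʸ; ofⁿ; det; fromEquivalence)

private variable A B : Set

<ᵇ-cong : ∀ {m n m′ n′} → m < n ⇔ m′ < n′ → (m <ᵇ n) ≡ (m′ <ᵇ n′)
<ᵇ-cong {m} {n} {m′} {n′} m<n⇔m′<n′ = det (<ᵇ-reflects-< m n)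
  (fromEquivalence (from ∘ <ᵇ⇒< m′ n′) (<⇒<ᵇ ∘ to))
  where open Equivalence m<n⇔m′<n′

<⇒<ᵇ≡true : ∀ {m n} → m < n → (m <ᵇ n) ≡ true
<⇒<ᵇ≡true {m} {n} m<n with m <ᵇ n | <ᵇ-reflects-< m n
... | true  | _       = refl
... | false | ofⁿ m≮n = ⊥-elim (m≮n m<n)

≤⇒>ᵇ≡false : ∀ {m n} → m ≤ n → (n <ᵇ m) ≡ false
≤⇒>ᵇ≡false {m} {n} m≤n with n <ᵇ m | <ᵇ-reflects-< n m
... | false | _       = refl
... | true  | ofʸ n<m = ⊥-elim (<⇒≱ n<m m≤n)

m+o<n+o⇔m<n : ∀ {m n} o → m + o < n + o ⇔ m < n
m+o<n+o⇔m<n {m} {n} o = mk⇔ (+-cancelʳ-< o m n) (+-monoˡ-< o)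

m∸o<n∸o⇒m<n : ∀ {m n o} → m ∸ o < n ∸ o → m < n
m∸o<n∸o⇒m<n {m} {n} {o} m∸o<n∸o with m <? n
... | yes m<n = m<n
... | no m≮n  = ⊥-elim (<⇒≱ m∸o<n∸o (∸-monoˡ-≤ o (≮⇒≥ m≮n)))

m∸o<n∸o⇔m<n : ∀ {m n o} → o < n → m ∸ o < n ∸ o ⇔ m < n
m∸o<n∸o⇔m<n {m} {n} {o} o<n = mk⇔ (m∸o<n∸o⇒m<n {o = o}) m<n⇒m∸o<n∸o
  where
  m<n⇒m∸o<n∸o : m < n → m ∸ o < n ∸ o
  m<n⇒m∸o<n∸o m<n with m ≤? o
  ... | yes m≤o = subst (_< n ∸ o) (sym (m≤n⇒m∸n≡0 m≤o)) (m<n⇒0<n∸m o<n)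
  ... | no m≰o  = ∸-monoˡ-< m<n (≮⇒≥ (m≰o ∘ <⇒≤))

maxL-upper : ∀ xs → All (_≤ maxL xs) xs
maxL-upper []       = []
maxL-upper (x ∷ xs) =
  m≤m⊔n x (maxL xs) ∷ All.map (λ y≤max → ≤-trans y≤max (m≤n⊔m x (maxL xs))) (maxL-upper xs)

maxL-least : ∀ {m xs} → All (_≤ m) xs → maxL xs ≤ m
maxL-least []             = z≤n
maxL-least (x≤m ∷ xs≤m) = ⊔-lub x≤m (maxL-least xs≤m)

maxL-∈ : ∀ x xs → maxL (x ∷ xs) ∈ x ∷ xs
maxL-∈ x []       = here (⊔-identityʳ x)
maxL-∈ x (y ∷ ys) with ⊔-sel x (maxL (y ∷ ys))
... | inj₁ max≡x   = here max≡x
... | inj₂ max≡max′ = there (subst (_∈ y ∷ ys) (sym max≡max′) (maxL-∈ y ys))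

maxL-map-∸ : ∀ a xs → maxL (map (_∸ a) xs) ≡ maxL xs ∸ a
maxL-map-∸ a []       = sym (0∸n≡0 a)
maxL-map-∸ a (x ∷ xs) =
  trans (cong ((x ∸ a) ⊔_) (maxL-map-∸ a xs)) (sym (∸-distribʳ-⊔ a x (maxL xs)))

break-∈ : ∀ {m xs α rest} → m ∈ xs → break (_≟ m) xs ≡ (α , rest) →
  Σ (List ℕ) λ β → rest ≡ m ∷ β × xs ≡ α ++ m ∷ β × All (_≢ m) α
break-∈ {m} {xs} m∈xs eq with trans (sym (span-defn (¬? ∘ (_≟ m)) xs)) eq
... | refl with dropWhile (¬? ∘ (_≟ m)) xs in dropped
              | Allₚ.all-head-dropWhile (¬? ∘ (_≟ m)) xs
              | takeWhile++dropWhile (¬? ∘ (_≟ m)) xs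
...   | []    | _         | _   = ⊥-elim (All.lookup (Allₚ.dropWhile⁻ (¬? ∘ (_≟ m)) dropped) m∈xs refl)
...   | y ∷ β | just ¬y≢m | xs≡ with refl ← decidable-stable (y ≟ m) ¬y≢m =
  β , refl , sym xs≡ , Allₚ.all-takeWhile (¬? ∘ (_≟ m)) xs

-- Right-to-left maxima

rlFlags-++-peak : ∀ xs {ys n} → All (_≤ n) xs → All (_≤ n) ys →
  rlFlags (xs ++ suc n ∷ ys) ≡ replicate (length xs) false ++ true ∷ rlFlags ys
rlFlags-++-peak []       {ys} _       ys≤n = cong (_∷ rlFlags ys) (<⇒<ᵇ≡true (s≤s (maxL-least ys≤n)))
rlFlags-++-peak (x ∷ xs) {ys} {n} (x≤n ∷ xs≤n) ys≤n =
  cong₂ _∷_ (≤⇒>ᵇ≡false x≤peak) (rlFlags-++-peak xs xs≤n ys≤n)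
  where
  x≤peak : x ≤ maxL (xs ++ suc n ∷ ys)
  x≤peak = ≤-trans (m≤n⇒m≤1+n x≤n)
    (All.lookup (maxL-upper (xs ++ suc n ∷ ys)) (∈-++⁺ʳ xs (here refl)))

rlFlags-map-∸ : ∀ {a ys} → All (a <_) ys → rlFlags (map (_∸ a) ys) ≡ rlFlags ys
rlFlags-map-∸               []             = refl
rlFlags-map-∸ {a} {y ∷ ys} (a<y ∷ a<ys) = cong₂ _∷_
  (trans (cong (_<ᵇ y ∸ a) (maxL-map-∸ a ys)) (<ᵇ-cong (m∸o<n∸o⇔m<n a<y)))
  (rlFlags-map-∸ a<ys)

-- Left-to-right maxima

lrFlagsFrom-++ : ∀ m xs ys → lrFlagsFrom m (xs ++ ys) ≡ lrFlagsFrom m xs ++ lrFlagsFrom (m ⊔ maxL xs) ys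
lrFlagsFrom-++ m []       ys = cong (λ k → lrFlagsFrom k ys) (sym (⊔-identityʳ m))
lrFlagsFrom-++ m (x ∷ xs) ys = cong ((m <ᵇ x) ∷_) (trans (lrFlagsFrom-++ (m ⊔ x) xs ys)
  (cong (λ k → lrFlagsFrom (m ⊔ x) xs ++ lrFlagsFrom k ys) (⊔-assoc m x (maxL xs))))

lrFlagsFrom-below : ∀ {m ys} → All (_≤ m) ys → lrFlagsFrom m ys ≡ replicate (length ys) false
lrFlagsFrom-below                []             = refl
lrFlagsFrom-below {m} {y ∷ ys} (y≤m ∷ ys≤m) = cong₂ _∷_ (≤⇒>ᵇ≡false y≤m)
  (trans (cong (λ k → lrFlagsFrom k ys) (m≥n⇒m⊔n≡m y≤m)) (lrFlagsFrom-below ys≤m))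

lrFlags-++-peak : ∀ xs {ys n} → All (_≤ n) xs → All (_≤ n) ys →
  lrFlags (xs ++ suc n ∷ ys) ≡ lrFlags xs ++ true ∷ replicate (length ys) false
lrFlags-++-peak xs {ys} {n} xs≤n ys≤n = begin
    lrFlags (xs ++ suc n ∷ ys)
  ≡⟨ lrFlagsFrom-++ 0 xs (suc n ∷ ys) ⟩
    lrFlags xs ++ (maxL xs <ᵇ suc n) ∷ lrFlagsFrom (maxL xs ⊔ suc n) ys
  ≡⟨ cong₂ (λ b bs → lrFlags xs ++ b ∷ bs) (<⇒<ᵇ≡true (s≤s (maxL-least xs≤n)))
       (lrFlagsFrom-below (All.map (m≤n⇒m≤o⊔n (maxL xs) ∘ m≤n⇒m≤1+n) ys≤n)) ⟩
    lrFlags xs ++ true ∷ replicate (length ys) false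
  ∎
  where open ≡-Reasoning

lrFlagsFrom-map-+ : ∀ c m xs → lrFlagsFrom (m + c) (map (_+ c) xs) ≡ lrFlagsFrom m xs
lrFlagsFrom-map-+ c m []       = refl
lrFlagsFrom-map-+ c m (x ∷ xs) = cong₂ _∷_ (<ᵇ-cong (m+o<n+o⇔m<n {m} {x} c))
  (trans (cong (λ k → lrFlagsFrom k (map (_+ c) xs)) (sym (+-distribʳ-⊔ c m x)))
         (lrFlagsFrom-map-+ c (m ⊔ x) xs))

lrFlags-map-+ : ∀ c {xs} → All (0 <_) xs → lrFlags (map (_+ c) xs) ≡ lrFlags xs
lrFlags-map-+ c []                       = refl
lrFlags-map-+ c {x ∷ xs} (0<x ∷ _) = cong₂ _∷_
  (trans (<⇒<ᵇ≡true (≤-trans 0<x (m≤m+n x c))) (sym (<⇒<ᵇ≡true 0<x)))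
  (lrFlagsFrom-map-+ c x xs)

-- Up-down words

-- upDown produces its letters through a local helper that also depends on the rest of the
-- list, so letters of different words can only be compared through their <ᵇ tests.
upDown-∷-∷-cong : ∀ {x y xs x′ y′ xs′} →
  (x <ᵇ y) ≡ (x′ <ᵇ y′) → upDown (y ∷ xs) ≡ upDown (y′ ∷ xs′) →
  upDown (x ∷ y ∷ xs) ≡ upDown (x′ ∷ y′ ∷ xs′)
upDown-∷-∷-cong {x} {y} {_} {x′} {y′} <ᵇ≡ ud≡ with x <ᵇ y | x′ <ᵇ y′
... | true  | true  = cong (u ∷_) ud≡
... | false | false = cong (d ∷_) ud≡
... | true  | false with () ← <ᵇ≡
... | false | true  with () ← <ᵇ≡

upDown-∷-∷-injective : ∀ {x y xs x′ y′ xs′} →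
  upDown (x ∷ y ∷ xs) ≡ upDown (x′ ∷ y′ ∷ xs′) →
  (x <ᵇ y) ≡ (x′ <ᵇ y′) × upDown (y ∷ xs) ≡ upDown (y′ ∷ xs′)
upDown-∷-∷-injective {x} {y} {_} {x′} {y′} ud≡ with x <ᵇ y | x′ <ᵇ y′
... | true  | true  = refl , ∷-injectiveʳ ud≡
... | false | false = refl , ∷-injectiveʳ ud≡
... | true  | false with () ← ∷-injectiveˡ ud≡
... | false | true  with () ← ∷-injectiveˡ ud≡

upDown-map : ∀ {D : ℕ → Set} (f : ℕ → ℕ) → (∀ {m n} → D n → f m < f n ⇔ m < n) →
  ∀ {xs} → All D xs → upDown (map f xs) ≡ upDown xs
upDown-map f faithful []       = refl
upDown-map f faithful (_ ∷ []) = refl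
upDown-map f faithful {x ∷ y ∷ _} (_ ∷ Dy ∷ Dxs) =
  upDown-∷-∷-cong (<ᵇ-cong (faithful {x} {y} Dy)) (upDown-map f faithful (Dy ∷ Dxs))

upDown-∷-peak : ∀ {n n′ ys ys′} → All (_< n) ys → All (_< n′) ys′ →
  length ys ≡ length ys′ → upDown ys ≡ upDown ys′ → upDown (n ∷ ys) ≡ upDown (n′ ∷ ys′)
upDown-∷-peak []          []            _ _   = refl
upDown-∷-peak (y<n ∷ _) (y′<n′ ∷ _) _ ud≡ =
  upDown-∷-∷-cong (trans (≤⇒>ᵇ≡false (<⇒≤ y<n)) (sym (≤⇒>ᵇ≡false (<⇒≤ y′<n′)))) ud≡

upDown-++-peak : ∀ {n n′} xs xs′ {ys ys′} → All (_< n) xs → All (_< n′) xs′ →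
  length xs ≡ length xs′ → upDown xs ≡ upDown xs′ → upDown (n ∷ ys) ≡ upDown (n′ ∷ ys′) →
  upDown (xs ++ n ∷ ys) ≡ upDown (xs′ ++ n′ ∷ ys′)
upDown-++-peak []       []        _ _ _ _ peak≡ = peak≡
upDown-++-peak (_ ∷ []) (_ ∷ []) (x<n ∷ _) (x′<n′ ∷ _) _ _ peak≡ =
  upDown-∷-∷-cong (trans (<⇒<ᵇ≡true x<n) (sym (<⇒<ᵇ≡true x′<n′))) peak≡
upDown-++-peak (_ ∷ y ∷ xs) (_ ∷ y′ ∷ xs′) (_ ∷ xs<n) (_ ∷ xs′<n′) |xs|≡ ud≡ peak≡
  with <ᵇ≡ , tail≡ ← upDown-∷-∷-injective ud≡ =
  upDown-∷-∷-cong <ᵇ≡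
    (upDown-++-peak (y ∷ xs) (y′ ∷ xs′) xs<n xs′<n′ (suc-injective |xs|≡) tail≡ peak≡)

interval : ℕ → ℕ → List ℕ
interval s = applyUpTo (λ i → suc (s + i))

InInterval : ℕ → ℕ → ℕ → Set
InInterval s k x = s < x × x ≤ s + k

length-interval : ∀ s k → length (interval s k) ≡ k
length-interval s = length-applyUpTo _

applyUpTo-cong : ∀ {f g : ℕ → A} → (∀ i → f i ≡ g i) → ∀ k → applyUpTo f k ≡ applyUpTo g k
applyUpTo-cong f≗g zero    = refl
applyUpTo-cong f≗g (suc k) = cong₂ _∷_ (f≗g 0) (applyUpTo-cong (f≗g ∘ suc) k)

applyUpTo-+ : ∀ (f : ℕ → A) k m → applyUpTo f (k + m) ≡ applyUpTo f k ++ applyUpTo (λ i → f (k + i)) m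
applyUpTo-+ f zero    m = refl
applyUpTo-+ f (suc k) m = cong (f 0 ∷_) (applyUpTo-+ (f ∘ suc) k m)

interval-split : ∀ a b → interval 0 (a + suc b) ≡ interval 0 a ++ interval a b ∷ʳ suc (a + b)
interval-split a b = trans (applyUpTo-+ suc a (suc b)) (cong (interval 0 a ++_) (sym (applyUpTo-∷ʳ _ b)))

map-∸-interval : ∀ a k → map (_∸ a) (interval a k) ≡ interval 0 k
map-∸-interval a k = trans (map-applyUpTo _ (_∸ a) k)
  (applyUpTo-cong (λ i → trans (cong (_∸ a) (sym (+-suc a i))) (m+n∸m≡n a (suc i))) k)

interval-bounds : ∀ s k → All (InInterval s k) (interval s k)
interval-bounds s k = Allₚ.applyUpTo⁺₁ _ k λ {i} i<k → s≤s (m≤m+n s i) , +-monoʳ-< s i<k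

interval-sorted : ∀ s k → AllPairs _≤_ (interval s k)
interval-sorted s k = AllPairsₚ.applyUpTo⁺₁ _ k λ i<j _ → s≤s (+-monoʳ-≤ s (<⇒≤ i<j))

map-suc-upTo : ∀ k → map suc (upTo k) ≡ interval 0 k
map-suc-upTo = map-applyUpTo (λ i → i) suc

sorted-↭⇒≡ : ∀ {xs ys} → AllPairs _≤_ xs → AllPairs _≤_ ys → xs ↭ ys → xs ≡ ys
sorted-↭⇒≡ xs↗ ys↗ xs↭ys = Pointwise-≡⇒≡ (Sortedₚ.↗↭↗⇒≋ ≤-totalOrder
  (Sortedₚ.AllPairs⇒Sorted ≤-totalOrder xs↗) (Sortedₚ.AllPairs⇒Sorted ≤-totalOrder ys↗)
  (↭⇒↭ₛ′ isEquivalence xs↭ys))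

sort-sorted : ∀ xs → AllPairs _≤_ (sort xs)
sort-sorted xs = Sortedₚ.Sorted⇒AllPairs ≤-totalOrder (sort-↗ xs)

All-sort : ∀ {P : ℕ → Set} xs → All P xs → All P (sort xs)
All-sort xs = ↭ₚ.All-resp-↭ (↭-sym (sort-↭ xs))

++-injective : ∀ (xs : List A) {xs′ ys ys′} → length xs ≡ length xs′ → xs ++ ys ≡ xs′ ++ ys′ →
  xs ≡ xs′ × ys ≡ ys′
++-injective []       {[]}      _      eq = refl , eq
++-injective (x ∷ xs) {x′ ∷ xs′} |xs|≡ eq with refl ← ∷-injectiveˡ eq =
  map₁ (cong (x ∷_)) (++-injective xs (suc-injective |xs|≡) (∷-injectiveʳ eq))

injectˡ : ∀ (xs ys : List A) → Fin (length xs) → Fin (length (xs ++ ys))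
injectˡ (_ ∷ xs) ys zero    = zero
injectˡ (_ ∷ xs) ys (suc i) = suc (injectˡ xs ys i)

toℕ-injectˡ : ∀ (xs ys : List A) i → toℕ (injectˡ xs ys i) ≡ toℕ i
toℕ-injectˡ (_ ∷ xs) ys zero    = refl
toℕ-injectˡ (_ ∷ xs) ys (suc i) = cong suc (toℕ-injectˡ xs ys i)

lookup-injectˡ : ∀ (xs ys : List A) i → lookup (xs ++ ys) (injectˡ xs ys i) ≡ lookup xs i
lookup-injectˡ (_ ∷ xs) ys zero    = refl
lookup-injectˡ (_ ∷ xs) ys (suc i) = lookup-injectˡ xs ys i

injectʳ : ∀ (xs ys : List A) → Fin (length ys) → Fin (length (xs ++ ys))
injectʳ []       ys i = i
injectʳ (_ ∷ xs) ys i = suc (injectʳ xs ys i)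

toℕ-injectʳ : ∀ (xs ys : List A) i → toℕ (injectʳ xs ys i) ≡ length xs + toℕ i
toℕ-injectʳ []       ys i = refl
toℕ-injectʳ (_ ∷ xs) ys i = cong suc (toℕ-injectʳ xs ys i)

lookup-injectʳ : ∀ (xs ys : List A) i → lookup (xs ++ ys) (injectʳ xs ys i) ≡ lookup ys i
lookup-injectʳ []       ys i = refl
lookup-injectʳ (_ ∷ xs) ys i = lookup-injectʳ xs ys i

unmap : ∀ (f : A → B) xs → Fin (length (map f xs)) → Fin (length xs)
unmap f (_ ∷ xs) zero    = zero
unmap f (_ ∷ xs) (suc i) = suc (unmap f xs i)

toℕ-unmap : ∀ (f : A → B) xs i → toℕ (unmap f xs i) ≡ toℕ i
toℕ-unmap f (_ ∷ xs) zero    = refl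
toℕ-unmap f (_ ∷ xs) (suc i) = cong suc (toℕ-unmap f xs i)

lookup-unmap : ∀ (f : A → B) xs i → lookup (map f xs) i ≡ f (lookup xs (unmap f xs i))
lookup-unmap f (_ ∷ xs) zero    = refl
lookup-unmap f (_ ∷ xs) (suc i) = lookup-unmap f xs i

Contains231-transport : ∀ {xs ys} (φ : Fin (length xs) → Fin (length ys)) →
  (∀ {i j} → toℕ i < toℕ j → toℕ (φ i) < toℕ (φ j)) →
  (∀ {i j} → lookup xs i < lookup xs j → lookup ys (φ i) < lookup ys (φ j)) →
  Contains231 xs → Contains231 ys
Contains231-transport φ φ-mono φ-values (i , j , k , i<j , j<k , πk<πi , πi<πj) =
  φ i , φ j , φ k , φ-mono i<j , φ-mono j<k , φ-values πk<πi , φ-values πi<πj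

Contains231-++⁺ˡ : ∀ xs ys → Contains231 xs → Contains231 (xs ++ ys)
Contains231-++⁺ˡ xs ys = Contains231-transport {xs} {xs ++ ys} (injectˡ xs ys)
  (λ {i} {j} → subst₂ _<_ (sym (toℕ-injectˡ xs ys i)) (sym (toℕ-injectˡ xs ys j)))
  (λ {i} {j} → subst₂ _<_ (sym (lookup-injectˡ xs ys i)) (sym (lookup-injectˡ xs ys j)))

Contains231-++⁺ʳ : ∀ xs ys → Contains231 ys → Contains231 (xs ++ ys)
Contains231-++⁺ʳ xs ys = Contains231-transport {ys} {xs ++ ys} (injectʳ xs ys)
  (λ {i} {j} → subst₂ _<_ (sym (toℕ-injectʳ xs ys i)) (sym (toℕ-injectʳ xs ys j)) ∘ +-monoʳ-< (length xs))
  (λ {i} {j} → subst₂ _<_ (sym (lookup-injectʳ xs ys i)) (sym (lookup-injectʳ xs ys j)))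

Contains231-map⁻ : ∀ f xs → (∀ {m n} → f m < f n → m < n) → Contains231 (map f xs) → Contains231 xs
Contains231-map⁻ f xs f-reflects = Contains231-transport {map f xs} {xs} (unmap f xs)
  (λ {i} {j} → subst₂ _<_ (sym (toℕ-unmap f xs i)) (sym (toℕ-unmap f xs j)))
  (λ {i} {j} → f-reflects ∘ subst₂ _<_ (lookup-unmap f xs i) (lookup-unmap f xs j))

Contains231-across : ∀ xs {n} ys (i : Fin (length xs)) (k : Fin (length ys)) →
  lookup ys k < lookup xs i → lookup xs i < n →
  Contains231 (xs ++ n ∷ ys)
Contains231-across xs {n} ys i k yₖ<xᵢ xᵢ<n =
  injectˡ xs (n ∷ ys) i , injectʳ xs (n ∷ ys) zero , injectʳ xs (n ∷ ys) (suc k) ,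
  subst₂ _<_ (sym (toℕ-injectˡ xs (n ∷ ys) i)) (sym (toℕ-injectʳ xs (n ∷ ys) zero))
    (≤-trans (toℕ<n i) (m≤m+n (length xs) 0)) ,
  subst₂ _<_ (sym (toℕ-injectʳ xs (n ∷ ys) zero)) (sym (toℕ-injectʳ xs (n ∷ ys) (suc k)))
    (+-monoʳ-< (length xs) z<s) ,
  subst₂ _<_ (sym (lookup-injectʳ xs (n ∷ ys) (suc k))) (sym (lookup-injectˡ xs (n ∷ ys) i)) yₖ<xᵢ ,
  subst₂ _<_ (sym (lookup-injectˡ xs (n ∷ ys) i)) (sym (lookup-injectʳ xs (n ∷ ys) zero)) xᵢ<n

-- Splitting a 231-avoider at its maximum

module PeakDecomposition {α β : List ℕ} {n : ℕ}
  (av : Av231 (α ++ n ∷ β)) (α<n : All (_< n) α) (β≤n : All (_≤ n) β) where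

  private
    a b : ℕ
    a = length α
    b = length β

  α≤β : All (λ x → All (x ≤_) β) α
  α≤β = All.tabulate λ x∈α → All.tabulate λ y∈β → ≮⇒≥ λ y<x →
    proj₂ av (Contains231-across α β (index x∈α) (index y∈β)
      (subst₂ _<_ (lookup-index y∈β) (lookup-index x∈α) y<x)
      (subst (_< n) (lookup-index x∈α) (All.lookup α<n x∈α)))

  -- Sorting α and β and appending n gives a sorted rearrangement of π, hence 1, …, |π|.
  sorted-entries : AllPairs _≤_ (sort α ++ sort β ∷ʳ n)
  sorted-entries = AllPairsₚ.++⁺ (sort-sorted α)
    (AllPairsₚ.++⁺ (sort-sorted β) ([] ∷ []) (All.map (_∷ []) (All-sort β β≤n)))
    (All-sort α (All.zipWith (λ (x≤β , x<n) → Allₚ.++⁺ (All-sort β x≤β) (<⇒≤ x<n ∷ []))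
                             (α≤β , α<n)))

  sorted-entries-↭ : sort α ++ sort β ∷ʳ n ↭ interval 0 (a + suc b)
  sorted-entries-↭ = ↭-trans
    (↭ₚ.++⁺ (sort-↭ α)
      (↭-trans (↭ₚ.++⁺ʳ (n ∷ []) (sort-↭ β)) (↭-sym (↭ₚ.∷↭∷ʳ n β))))
    (subst (α ++ n ∷ β ↭_) (trans (map-suc-upTo _) (cong (interval 0) (length-++ α))) (proj₁ av))

  sorted-entries≡ : sort α ++ sort β ∷ʳ n ≡ interval 0 a ++ interval a b ∷ʳ suc (a + b)
  sorted-entries≡ = trans (sorted-↭⇒≡ sorted-entries (interval-sorted 0 (a + suc b)) sorted-entries-↭)
                          (interval-split a b)

  sorted-entries-split : sort α ≡ interval 0 a × sort β ∷ʳ n ≡ interval a b ∷ʳ suc (a + b)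
  sorted-entries-split = ++-injective (sort α) (trans (↭ₚ.↭-length (sort-↭ α)) (sym (length-interval 0 a)))
                                       sorted-entries≡

  α↭interval : α ↭ interval 0 a
  α↭interval = subst (α ↭_) (proj₁ sorted-entries-split) (↭-sym (sort-↭ α))

  sorted-β-split : sort β ≡ interval a b × n ≡ suc (a + b)
  sorted-β-split = ∷ʳ-injective (sort β) (interval a b) (proj₂ sorted-entries-split)

  β↭interval : β ↭ interval a b
  β↭interval = subst (β ↭_) (proj₁ sorted-β-split) (↭-sym (sort-↭ β))

  peak≡ : n ≡ suc (a + b)
  peak≡ = proj₂ sorted-β-split

  α-bounds : All (InInterval 0 a) α
  α-bounds = ↭ₚ.All-resp-↭ (↭-sym α↭interval) (interval-bounds 0 a)

  β-bounds : All (InInterval a b) β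
  β-bounds = ↭ₚ.All-resp-↭ (↭-sym β↭interval) (interval-bounds a b)

  Av231-left : Av231 α
  Av231-left = subst (α ↭_) (sym (map-suc-upTo a)) α↭interval , proj₂ av ∘ Contains231-++⁺ˡ α (n ∷ β)

  Av231-right : Av231 (map (_∸ a) β)
  Av231-right = perm , proj₂ av ∘ Contains231-++⁺ʳ α (n ∷ β) ∘ Contains231-++⁺ʳ (n ∷ []) β
                                ∘ Contains231-map⁻ (_∸ a) β (m∸o<n∸o⇒m<n {o = a})
    where
    perm : map (_∸ a) β ↭ map suc (upTo (length (map (_∸ a) β)))
    perm = subst (map (_∸ a) β ↭_)
      (trans (map-∸-interval a b) (sym (trans (map-suc-upTo _) (cong (interval 0) (length-map _ β)))))
      (↭ₚ.map⁺ (_∸ a) β↭interval)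

-- The field bounds is the extra invariant that keeps P α + |β| and P β below the peak.
record SameStatistics (π σ : List ℕ) : Set where
  field
    length≡  : length σ ≡ length π
    bounds   : All (InInterval 0 (length π)) σ
    rlFlags≡ : rlFlags π ≡ rlFlags σ
    lrFlags≡ : lrFlags π ≡ lrFlags σ
    upDown≡  : upDown π ≡ upDown σ

SameStatistics-[] : SameStatistics [] []
SameStatistics-[] = record { length≡ = refl ; bounds = [] ; rlFlags≡ = refl ; lrFlags≡ = refl ; upDown≡ = refl }

module PeakCombination {α β Pα Pβ : List ℕ}
  (α-bounds : All (InInterval 0 (length α)) α) (β-bounds : All (InInterval (length α) (length β)) β)
  (Sα : SameStatistics α Pα) (Sβ : SameStatistics (map (_∸ length α) β) Pβ) where

  private
    module Sα = SameStatistics Sα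
    module Sβ = SameStatistics Sβ

    a b N : ℕ
    a = length α
    b = length β
    N = suc (a + b)

    Pα⁺ : List ℕ
    Pα⁺ = map (_+ b) Pα

    |Pα⁺|≡a : length Pα⁺ ≡ a
    |Pα⁺|≡a = trans (length-map _ Pα) Sα.length≡

    |Pβ|≡b : length Pβ ≡ b
    |Pβ|≡b = trans Sβ.length≡ (length-map _ β)

    |π|≡N : length (α ++ N ∷ β) ≡ N
    |π|≡N = trans (length-++ α) (+-suc a b)

    α≤ : All (_≤ a + b) α
    α≤ = All.map (λ (_ , x≤a) → ≤-trans x≤a (m≤m+n a b)) α-bounds

    β≤ : All (_≤ a + b) β
    β≤ = All.map proj₂ β-bounds

    Pα⁺≤ : All (_≤ a + b) Pα⁺
    Pα⁺≤ = Allₚ.map⁺ (All.map (λ (_ , x≤a) → +-monoˡ-≤ b x≤a) Sα.bounds)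

    ≤b⇒≤a+b : ∀ {x} → x ≤ length (map (_∸ a) β) → x ≤ a + b
    ≤b⇒≤a+b x≤ = ≤-trans x≤ (≤-trans (≤-reflexive (length-map _ β)) (m≤n+m b a))

    Pβ≤ : All (_≤ a + b) Pβ
    Pβ≤ = All.map (≤b⇒≤a+b ∘ proj₂) Sβ.bounds

    ≤a+b⇒≤|π| : ∀ {x} → x ≤ a + b → x ≤ length (α ++ N ∷ β)
    ≤a+b⇒≤|π| x≤ = ≤-trans (m≤n⇒m≤1+n x≤) (≤-reflexive (sym |π|≡N))

  length≡ : length (Pα⁺ ++ N ∷ Pβ) ≡ length (α ++ N ∷ β)
  length≡ = trans (length-++ Pα⁺)
    (trans (cong₂ (λ k l → k + suc l) |Pα⁺|≡a |Pβ|≡b) (sym (length-++ α)))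

  bounds : All (InInterval 0 (length (α ++ N ∷ β))) (Pα⁺ ++ N ∷ Pβ)
  bounds = Allₚ.++⁺ (Allₚ.map⁺ (All.map shift-bound Sα.bounds))
    ((z<s , ≤-reflexive (sym |π|≡N)) ∷ All.map (λ (0<x , x≤) → 0<x , ≤a+b⇒≤|π| (≤b⇒≤a+b x≤)) Sβ.bounds)
    where
    shift-bound : ∀ {x} → InInterval 0 a x → InInterval 0 (length (α ++ N ∷ β)) (x + b)
    shift-bound {x} (0<x , x≤a) = ≤-trans 0<x (m≤m+n x b) , ≤a+b⇒≤|π| (+-monoˡ-≤ b x≤a)

  rlFlags≡ : rlFlags (α ++ N ∷ β) ≡ rlFlags (Pα⁺ ++ N ∷ Pβ)
  rlFlags≡ = begin
    rlFlags (α ++ N ∷ β)                              ≡⟨ rlFlags-++-peak α α≤ β≤ ⟩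
    replicate a false ++ true ∷ rlFlags β             ≡⟨ cong₂ (λ k bs → replicate k false ++ true ∷ bs)
                                                               (sym |Pα⁺|≡a) rlFlags-β ⟩
    replicate (length Pα⁺) false ++ true ∷ rlFlags Pβ ≡⟨ sym (rlFlags-++-peak Pα⁺ Pα⁺≤ Pβ≤) ⟩
    rlFlags (Pα⁺ ++ N ∷ Pβ)                           ∎
    where
    open ≡-Reasoning
    rlFlags-β : rlFlags β ≡ rlFlags Pβ
    rlFlags-β = trans (sym (rlFlags-map-∸ (All.map proj₁ β-bounds))) Sβ.rlFlags≡

  lrFlags≡ : lrFlags (α ++ N ∷ β) ≡ lrFlags (Pα⁺ ++ N ∷ Pβ)
  lrFlags≡ = begin
    lrFlags (α ++ N ∷ β)                              ≡⟨ lrFlags-++-peak α α≤ β≤ ⟩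
    lrFlags α ++ true ∷ replicate b false             ≡⟨ cong₂ (λ bs k → bs ++ true ∷ replicate k false)
                                                               lrFlags-α (sym |Pβ|≡b) ⟩
    lrFlags Pα⁺ ++ true ∷ replicate (length Pβ) false ≡⟨ sym (lrFlags-++-peak Pα⁺ Pα⁺≤ Pβ≤) ⟩
    lrFlags (Pα⁺ ++ N ∷ Pβ)                           ∎
    where
    open ≡-Reasoning
    lrFlags-α : lrFlags α ≡ lrFlags Pα⁺
    lrFlags-α = trans Sα.lrFlags≡ (sym (lrFlags-map-+ b (All.map proj₁ Sα.bounds)))

  upDown≡ : upDown (α ++ N ∷ β) ≡ upDown (Pα⁺ ++ N ∷ Pβ)
  upDown≡ = upDown-++-peak α Pα⁺ (All.map s≤s α≤) (All.map s≤s Pα⁺≤) (sym |Pα⁺|≡a) upDown-α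
    (upDown-∷-peak (All.map s≤s β≤) (All.map s≤s Pβ≤) (sym |Pβ|≡b) upDown-β)
    where
    upDown-α : upDown α ≡ upDown Pα⁺
    upDown-α = trans Sα.upDown≡ (sym (upDown-map (_+ b) (λ _ → m+o<n+o⇔m<n b) Sα.bounds))
    upDown-β : upDown β ≡ upDown Pβ
    upDown-β = trans (sym (upDown-map (_∸ a) (m∸o<n∸o⇔m<n ∘ proj₁) β-bounds)) Sβ.upDown≡

  same-statistics : SameStatistics (α ++ N ∷ β) (Pα⁺ ++ N ∷ Pβ)
  same-statistics = record
    { length≡ = length≡ ; bounds = bounds
    ; rlFlags≡ = rlFlags≡ ; lrFlags≡ = lrFlags≡ ; upDown≡ = upDown≡
    }

P-statistics : ∀ f π → length π ≤ f → Av231 π → SameStatistics π (Pfuel f π)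
P-statistics zero    []       _   _  = SameStatistics-[]
P-statistics (suc f) []       _   _  = SameStatistics-[]
P-statistics (suc f) (x ∷ xs) |π|≤ av with break (_≟ maxL (x ∷ xs)) (x ∷ xs) in eq
... | α , rest with break-∈ (maxL-∈ x xs) eq
... | β , refl , π≡ , α≢max rewrite length-map (_∸ length α) β =
  subst (λ σ → SameStatistics σ Pπ) (trans (cong (λ m → α ++ m ∷ β) (sym peak≡)) (sym π≡))
    (PeakCombination.same-statistics α-bounds β-bounds
      (P-statistics f α (≤-trans (m≤m+n _ _) a+b≤f) Av231-left)
      (P-statistics f (map (_∸ length α) β) |β|≤f Av231-right))
  where
  Pπ : List ℕ
  Pπ = map (_+ length β) (Pfuel f α) ++ suc (length α + length β) ∷ Pfuel f (map (_∸ length α) β)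
  entries≤max : All (_≤ maxL (x ∷ xs)) (α ++ maxL (x ∷ xs) ∷ β)
  entries≤max = subst (All (_≤ maxL (x ∷ xs))) π≡ (maxL-upper (x ∷ xs))
  α<max : All (_< maxL (x ∷ xs)) α
  α<max = All.zipWith (uncurry ≤∧≢⇒<) (Allₚ.++⁻ˡ α entries≤max , α≢max)
  β≤max : All (_≤ maxL (x ∷ xs)) β
  β≤max = All.tail (Allₚ.++⁻ʳ α entries≤max)
  open PeakDecomposition (subst Av231 π≡ av) α<max β≤max
  a+b≤f : length α + length β ≤ f
  a+b≤f = s≤s⁻¹ (subst (_≤ suc f) (trans (cong length π≡) (trans (length-++ α) (+-suc _ _))) |π|≤)
  |β|≤f : length (map (_∸ length α) β) ≤ f
  |β|≤f = subst (_≤ f) (sym (length-map _ β)) (≤-trans (m≤n+m _ _) a+b≤f)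

corollary3p5 : ∀ (π : List ℕ) → Av231 π →
    (length (rlMaxPositions π) ≡ length (rlMaxPositions (P π)))
    × (rlMaxPositions π ≡ rlMaxPositions (P π))
    × (length (lrMaxPositions π) ≡ length (lrMaxPositions (P π)))
    × (lrMaxPositions π ≡ lrMaxPositions (P π))
    × (upDown π ≡ upDown (P π))
corollary3p5 π av =
  cong (length ∘ truePositionsFrom 0) rlFlags≡ , cong (truePositionsFrom 0) rlFlags≡ ,
  cong (length ∘ truePositionsFrom 0) lrFlags≡ , cong (truePositionsFrom 0) lrFlags≡ , upDown≡
  where open SameStatistics (P-statistics (length π) π ≤-refl av)
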